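{- Let $P=(\Sigma,\mathit{Init}(\vec p),\mathit{Mod}(p),\mathit{TrLoc}(p),\mathcal{C})$ be a first-order protocol, and for each topological class $\mathit{Top}\in\Sigma_T$ (say $\Sigma_T=\{\mathit{Top}_1,\dots,\mathit{Top}_n\}$) let $\mathit{Inv}_{\mathit{Top}}(\vec p)$ be a local invariant. If $\models VC(\mathit{Inv})$ (validity in ordinary first-order logic), then $\models_{\mathcal{C}} \mathit{InvOk}(\mathit{Inv})$.
   Context: Work in many-sorted first-order logic (FOL) with a distinguished sort $\mathit{Proc}$ of processes. A topological signature is $\Sigma^{\mathcal C}=\Sigma_E\uplus\Sigma_T$, where $\Sigma_E$ is a set of unary functions $\mathit{Proc}\to\mathit{Proc}$ (edge names) and $\Sigma_T$ is a set of $k$-ary predicates on $\mathit{Proc}$ (topological classes), $k$ fixed. A network topology $\mathcal C$ over $\Sigma^{\mathcal C}$ is a collection of directed graphs $G=(V,E)$ with an edge labelling $\mathit{dir}:E\to\Sigma_E$ and a labelling of $k$-tuples of nodes by elements of $\Sigma_T$. The intended interpretation $\mathcal I_G$ of $G$ takes $V$ as the domain of $\mathit{Proc}$, makes $P\in\Sigma_T$ true exactly of the tuples labelled $P$, and sets $f(p)=q$ if the edge $(p,q)$ is labelled $f\in\Sigma_E$ and $f(p)=p$ otherwise. A $\mathcal C$-interpretation is an FOL interpretation whose $\mathit{Proc}$-domain and interpretation of $\Sigma^{\mathcal C}$ is $\mathcal I_G$ for some $G\in\mathcal C$; $\models_{\mathcal C}\varphi$ means every $\mathcal C$-interpretation satisfies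 $\varphi$, while $\models\varphi$ means $\varphi$ is valid in ordinary FOL. A protocol signature is $\Sigma=\Sigma^{\mathcal C}\uplus\Sigma_S\uplus\Sigma_B$, where every symbol of $\Sigma_S$ (state) has arity $\ge1$ with its first and only its first argument of sort $\mathit{Proc}$, and symbols of $\Sigma_B$ (background) have no $\mathit{Proc}$ arguments. For a signature $\Sigma$, $\Sigma'=\{t'\mid t\in\Sigma\}$ is a primed copy (post-state). A first-order protocol is $P=(\Sigma,\mathit{Init}(\vec p),\mathit{Mod}(p),\mathit{TrLoc}(p),\mathcal C)$ where $\vec p=(p_1,\dots,p_k)$; $\mathit{Init}(\vec p)=\bigwedge_{\mathit{Top}\in\Sigma_T}(\mathit{Top}(\vec p)\Rightarrow \mathit{Init}_{\mathit{Top}}(\vec p))$ with each $\mathit{Init}_{\mathit{Top}}$ over $\Sigma\setminus\Sigma^{\mathcal C}$; $\mathit{Mod}(p)=\{p\}\cup\{f(p)\mid f\in\Sigma_E\}$; and $\mathit{TrLoc}(p)$ is a formula over $\Sigma\cup\Sigma'$ whose $\mathit{Proc}$-sorted terms all lie in $\mathit{Mod}(p)$. Define $\mathit{Unch}(y)=\bigwedge_{P\in\mathit{Pred}_S}\forall\vec v\,(P(y,\vec v)\Leftrightarrow P'(y,\vec v))\wedge\bigwedge_{f\in\mathit{Func}_S}\forall\vec v\,(f(y,\vec v)=f'(y,\vec v))$, $\mathit{UnMod}=\bigwedge_{P\in\mathit{Pred}_B}\forall\vec v\,(P(\vec v)\Leftrightarrow P'(\vec v))\wedge\bigwedge_{f\in\mathit{Func}_B}\forall\vec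 v\,(f(\vec v)=f'(\vec v))$, $\mathit{Frame}(p)=\mathit{UnMod}\wedge\forall y\,(y\notin\mathit{Mod}(p)\Rightarrow\mathit{Unch}(y))$ (where $y\notin\mathit{Mod}(p)$ means $y$ differs from every term of $\mathit{Mod}(p)$), $\tau(p)=\mathit{TrLoc}(p)\wedge\mathit{Frame}(p)$ and $\tau=\exists p\,\tau(p)$. A candidate invariant consists of, for each $\mathit{Top}\in\Sigma_T$, a formula $\mathit{Inv}_{\mathit{Top}}(\vec q)$ over $\Sigma_S\cup\Sigma_B$ with $k$ free $\mathit{Proc}$ variables; $\mathit{Inv}(\vec q)=\bigwedge_{\mathit{Top}\in\Sigma_T}(\mathit{Top}(\vec q)\Rightarrow\mathit{Inv}_{\mathit{Top}}(\vec q))$. Define $\mathit{InvOk}(\mathit{Inv})=((\forall\vec p\,\mathit{Init}(\vec p))\Rightarrow\forall\vec p\,\mathit{Inv}(\vec p))\wedge((\forall\vec p\,\mathit{Inv}(\vec p))\wedge\tau\Rightarrow\forall\vec p\,\mathit{Inv}'(\vec p))$. For a set $A$ of $\mathit{Proc}$-terms and $\mathit{Top}\in\Sigma_T$, $\chi_{\mathit{Top}}(A,\vec q)$ is the strongest formula such that (1) it is over $\Sigma_T\cup\Sigma_E\cup\{=\}$, (2) its $\mathit{Proc}$-terms are among $A\cup\{q_1,\dots,q_k\}$, (3) it is in CNF with all $\Sigma_T$-literals positive, and $\models_{\mathcal C}\forall\vec q\,(\mathit{Top}(\vec q)\Rightarrow\chi_{\mathit{Top}}(A,\vec q))$. $\mathit{CrossInit}_{\mathit{Top}}(\vec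 q)$ is obtained from $\chi_{\mathit{Top}}(\emptyset,\vec q)$ by replacing each atom $\mathit{Top}_j(\vec t)$ with $\mathit{Init}_{\mathit{Top}_j}(\vec t)$; $\mathit{CrossInv}_{\mathit{Top}}(\mathit{Mod}(p),\vec q)$ is obtained from $\chi_{\mathit{Top}}(\mathit{Mod}(p),\vec q)$ by replacing each atom $\mathit{Top}_j(\vec t)$ with $\mathit{Top}_j(\vec t)\wedge\mathit{Inv}_{\mathit{Top}_j}(\vec t)$. The verification condition $VC(\mathit{Inv})$ is the conjunction over all $\mathit{Top}\in\Sigma_T$ of $\forall\vec q\,(\mathit{CrossInit}_{\mathit{Top}}(\vec q)\Rightarrow\mathit{Inv}_{\mathit{Top}}(\vec q))$ and $\forall p,\vec q\,((\mathit{CrossInv}_{\mathit{Top}}(\mathit{Mod}(p),\vec q)\wedge\tau(p))\Rightarrow\mathit{Inv}'_{\mathit{Top}}(\vec q))$. -}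

module Defs where

open import Function using (_∘_)
open import Data.Nat using (ℕ; zero; suc)
open import Data.Fin using (Fin; zero; suc)
open import Data.List using (List; []; _∷_; _++_; length)
import Data.List as L
open import Data.Vec using (Vec; []; _∷_)
import Data.Vec as V
open import Data.Bool using (Bool; true; false)
open import Data.Maybe using (Maybe; just)
open import Data.Product using (Σ; _×_; _,_)
open import Data.Sum using (_⊎_)
open import Data.Unit using (⊤)
open import Data.Empty using (⊥)
open import Relation.Binary.PropositionalEquality using (_≡_)
open import Relation.Nullary using (¬_)

data Sort (DSort : Set) : Set where
  proc : Sort DSort
  dat  : DSort → Sort DSort

-- A protocol signature  Σ = Σ^C ⊎ Σ_S ⊎ Σ_B  (finite).
--  * Σ_E : nE unary edge functions Proc → Proc
--  * Σ_T : nT k-ary topology predicates on Proc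
--  * Σ_S : state predicates / functions; first argument Proc, the other
--          arguments of non-Proc sorts (result sort of a function arbitrary)
--  * Σ_B : background predicates / functions, no Proc arguments

record ProtSig : Set₁ where
  field
    DSort  : Set
    nE nT k : ℕ
    nSP nSF nBP nBF : ℕ
    spArgs : Fin nSP → List DSort
    sfArgs : Fin nSF → List DSort
    sfRes  : Fin nSF → Sort DSort
    bpArgs : Fin nBP → List DSort
    bfArgs : Fin nBF → List DSort
    bfRes  : Fin nBF → Sort DSort

module FO (S : ProtSig) where
  open ProtSig S public

  Srt : Set
  Srt = Sort DSort

  Ctx : Set
  Ctx = List Srt

  dats : List DSort → Ctx
  dats = L.map dat

  procs : ℕ → Ctx
  procs zero    = []
  procs (suc n) = proc ∷ procs n

  -- Symbols of Σ ∪ Σ'.  The flag 'primed' selects the post-state copy of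
  -- a state / background symbol.  The topology Σ^C is static (unprimed).

  data FunSym : Ctx → Srt → Set where
    edge : Fin nE → FunSym (proc ∷ []) proc
    sfun : (primed : Bool) (i : Fin nSF) → FunSym (proc ∷ dats (sfArgs i)) (sfRes i)
    bfun : (primed : Bool) (i : Fin nBF) → FunSym (dats (bfArgs i)) (bfRes i)

  data PredSym : Ctx → Set where
    top   : Fin nT → PredSym (procs k)
    spred : (primed : Bool) (i : Fin nSP) → PredSym (proc ∷ dats (spArgs i))
    bpred : (primed : Bool) (i : Fin nBP) → PredSym (dats (bpArgs i))

  data _∋_ : Ctx → Srt → Set where
    here  : ∀ {Γ s} → (s ∷ Γ) ∋ s
    there : ∀ {Γ s t} → Γ ∋ s → (t ∷ Γ) ∋ s

  mutual
    data Term (Γ : Ctx) : Srt → Set where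
      var : ∀ {s} → Γ ∋ s → Term Γ s
      app : ∀ {ss s} → FunSym ss s → Terms Γ ss → Term Γ s

    data Terms (Γ : Ctx) : Ctx → Set where
      []  : Terms Γ []
      _∷_ : ∀ {s ss} → Term Γ s → Terms Γ ss → Terms Γ (s ∷ ss)

  infixr 6 _∧ᶠ_
  infixr 5 _∨ᶠ_
  infixr 4 _⇒ᶠ_ _⇔ᶠ_

  data Formula (Γ : Ctx) : Set where
    tt ff : Formula Γ
    atom  : ∀ {ss} → PredSym ss → Terms Γ ss → Formula Γ
    eq    : ∀ {s} → Term Γ s → Term Γ s → Formula Γ
    neg   : Formula Γ → Formula Γ
    _∧ᶠ_ _∨ᶠ_ _⇒ᶠ_ : Formula Γ → Formula Γ → Formula Γ
    all ex : (s : Srt) → Formula (s ∷ Γ) → Formula Γ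

  _⇔ᶠ_ : ∀ {Γ} → Formula Γ → Formula Γ → Formula Γ
  φ ⇔ᶠ ψ = (φ ⇒ᶠ ψ) ∧ᶠ (ψ ⇒ᶠ φ)

  Ren : Ctx → Ctx → Set
  Ren Γ Δ = ∀ {s} → Γ ∋ s → Δ ∋ s

  liftR : ∀ {Γ Δ t} → Ren Γ Δ → Ren (t ∷ Γ) (t ∷ Δ)
  liftR ρ here      = here
  liftR ρ (there x) = there (ρ x)

  mutual
    renT : ∀ {Γ Δ s} → Ren Γ Δ → Term Γ s → Term Δ s
    renT ρ (var x)    = var (ρ x)
    renT ρ (app f ts) = app f (renTs ρ ts)

    renTs : ∀ {Γ Δ ss} → Ren Γ Δ → Terms Γ ss → Terms Δ ss
    renTs ρ []       = []
    renTs ρ (t ∷ ts) = renT ρ t ∷ renTs ρ ts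

  renF : ∀ {Γ Δ} → Ren Γ Δ → Formula Γ → Formula Δ
  renF ρ tt         = tt
  renF ρ ff         = ff
  renF ρ (atom P ts) = atom P (renTs ρ ts)
  renF ρ (eq t u)   = eq (renT ρ t) (renT ρ u)
  renF ρ (neg φ)    = neg (renF ρ φ)
  renF ρ (φ ∧ᶠ ψ)   = renF ρ φ ∧ᶠ renF ρ ψ
  renF ρ (φ ∨ᶠ ψ)   = renF ρ φ ∨ᶠ renF ρ ψ
  renF ρ (φ ⇒ᶠ ψ)   = renF ρ φ ⇒ᶠ renF ρ ψ
  renF ρ (all s φ)  = all s (renF (liftR ρ) φ)
  renF ρ (ex s φ)   = ex s (renF (liftR ρ) φ)

  Sub : Ctx → Ctx → Set
  Sub Γ Δ = ∀ {s} → Γ ∋ s → Term Δ s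

  liftS : ∀ {Γ Δ t} → Sub Γ Δ → Sub (t ∷ Γ) (t ∷ Δ)
  liftS σ here      = var here
  liftS σ (there x) = renT there (σ x)

  mutual
    subT : ∀ {Γ Δ s} → Sub Γ Δ → Term Γ s → Term Δ s
    subT σ (var x)    = σ x
    subT σ (app f ts) = app f (subTs σ ts)

    subTs : ∀ {Γ Δ ss} → Sub Γ Δ → Terms Γ ss → Terms Δ ss
    subTs σ []       = []
    subTs σ (t ∷ ts) = subT σ t ∷ subTs σ ts

  subF : ∀ {Γ Δ} → Sub Γ Δ → Formula Γ → Formula Δ
  subF σ tt          = tt
  subF σ ff          = ff
  subF σ (atom P ts) = atom P (subTs σ ts)
  subF σ (eq t u)    = eq (subT σ t) (subT σ u)
  subF σ (neg φ)     = neg (subF σ φ)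
  subF σ (φ ∧ᶠ ψ)    = subF σ φ ∧ᶠ subF σ ψ
  subF σ (φ ∨ᶠ ψ)    = subF σ φ ∨ᶠ subF σ ψ
  subF σ (φ ⇒ᶠ ψ)    = subF σ φ ⇒ᶠ subF σ ψ
  subF σ (all s φ)   = all s (subF (liftS σ) φ)
  subF σ (ex s φ)    = ex s (subF (liftS σ) φ)

  primeFun : ∀ {ss s} → FunSym ss s → FunSym ss s
  primeFun (edge e)   = edge e
  primeFun (sfun _ i) = sfun true i
  primeFun (bfun _ i) = bfun true i

  primePred : ∀ {ss} → PredSym ss → PredSym ss
  primePred (top t)     = top t
  primePred (spred _ i) = spred true i
  primePred (bpred _ i) = bpred true i

  mutual
    primeT : ∀ {Γ s} → Term Γ s → Term Γ s
    primeT (var x)    = var x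
    primeT (app f ts) = app (primeFun f) (primeTs ts)

    primeTs : ∀ {Γ ss} → Terms Γ ss → Terms Γ ss
    primeTs []       = []
    primeTs (t ∷ ts) = primeT t ∷ primeTs ts

  primeF : ∀ {Γ} → Formula Γ → Formula Γ
  primeF tt          = tt
  primeF ff          = ff
  primeF (atom P ts) = atom (primePred P) (primeTs ts)
  primeF (eq t u)    = eq (primeT t) (primeT u)
  primeF (neg φ)     = neg (primeF φ)
  primeF (φ ∧ᶠ ψ)    = primeF φ ∧ᶠ primeF ψ
  primeF (φ ∨ᶠ ψ)    = primeF φ ∨ᶠ primeF ψ
  primeF (φ ⇒ᶠ ψ)    = primeF φ ⇒ᶠ primeF ψ
  primeF (all s φ)   = all s (primeF φ)
  primeF (ex s φ)    = ex s (primeF φ)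

  data Env (D : Srt → Set) : Ctx → Set where
    []  : Env D []
    _∷_ : ∀ {s ss} → D s → Env D ss → Env D (s ∷ ss)

  lookupE : ∀ {D Γ s} → Env D Γ → Γ ∋ s → D s
  lookupE (d ∷ ρ) here      = d
  lookupE (d ∷ ρ) (there x) = lookupE ρ x

  record Structure : Set₁ where
    field
      D         : Srt → Set
      inhabited : ∀ s → D s
      funI      : ∀ {ss s} → FunSym ss s → Env D ss → D s
      predI     : ∀ {ss} → PredSym ss → Env D ss → Set
  open Structure public

  mutual
    evalT : ∀ {Γ s} (M : Structure) → Env (D M) Γ → Term Γ s → D M s
    evalT M ρ (var x)    = lookupE ρ x
    evalT M ρ (app f ts) = funI M f (evalTs M ρ ts)

    evalTs : ∀ {Γ ss} (M : Structure) → Env (D M) Γ → Terms Γ ss → Env (D M) ss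
    evalTs M ρ []       = []
    evalTs M ρ (t ∷ ts) = evalT M ρ t ∷ evalTs M ρ ts

  ⟦_⟧ : ∀ {Γ} → Formula Γ → (M : Structure) → Env (D M) Γ → Set
  ⟦ tt ⟧        M ρ = ⊤
  ⟦ ff ⟧        M ρ = ⊥
  ⟦ atom P ts ⟧ M ρ = predI M P (evalTs M ρ ts)
  ⟦ eq t u ⟧    M ρ = evalT M ρ t ≡ evalT M ρ u
  ⟦ neg φ ⟧     M ρ = ¬ ⟦ φ ⟧ M ρ
  ⟦ φ ∧ᶠ ψ ⟧    M ρ = ⟦ φ ⟧ M ρ × ⟦ ψ ⟧ M ρ
  ⟦ φ ∨ᶠ ψ ⟧    M ρ = ⟦ φ ⟧ M ρ ⊎ ⟦ ψ ⟧ M ρ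
  ⟦ φ ⇒ᶠ ψ ⟧    M ρ = ⟦ φ ⟧ M ρ → ⟦ ψ ⟧ M ρ
  ⟦ all s φ ⟧   M ρ = (d : D M s) → ⟦ φ ⟧ M (d ∷ ρ)
  ⟦ ex s φ ⟧    M ρ = Σ (D M s) λ d → ⟦ φ ⟧ M (d ∷ ρ)

  Valid : ∀ {Γ} → Formula Γ → Set₁
  Valid φ = (M : Structure) (ρ : Env (D M) _) → ⟦ φ ⟧ M ρ

  -- a directed graph on node set V, edges labelled by Σ_E (dir),
  -- and a (partial) labelling of k-tuples of nodes by Σ_T
  record Graph (V : Set) : Set₁ where
    field
      Edge  : V → V → Set
      dir   : ∀ {u v} → Edge u v → Fin nE
      label : Vec V k → Maybe (Fin nT)
  open Graph public

  Topology : Set₁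
  Topology = (V : Set) → Graph V → Set

  envVec : ∀ {D n} → Env D (procs n) → Vec (D proc) n
  envVec {n = zero}  []      = []
  envVec {n = suc n} (d ∷ ρ) = d ∷ envVec ρ

  LabelledEdge : ∀ {V} → Graph V → Fin nE → V → V → Set
  LabelledEdge G e u v = Σ (Edge G u v) λ ed → dir G ed ≡ e

  record IsIntended (M : Structure) (G : Graph (D M proc)) : Set where
    field
      top⇒label : ∀ t (ρ : Env (D M) (procs k)) → predI M (top t) ρ → label G (envVec ρ) ≡ just t
      label⇒top : ∀ t (ρ : Env (D M) (procs k)) → label G (envVec ρ) ≡ just t → predI M (top t) ρ
      edge-to   : ∀ e u v → LabelledEdge G e u v → funI M (edge e) (u ∷ []) ≡ v
      edge-self : ∀ e u → ¬ (Σ (D M proc) λ v → LabelledEdge G e u v) → funI M (edge e) (u ∷ []) ≡ u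

  IsCInterp : Topology → Structure → Set₁
  IsCInterp C M = Σ (Graph (D M proc)) λ G → C (D M proc) G × IsIntended M G

  ValidC : ∀ {Γ} → Topology → Formula Γ → Set₁
  ValidC C φ = (M : Structure) → IsCInterp C M → (ρ : Env (D M) _) → ⟦ φ ⟧ M ρ

  SBFun : ∀ {ss s} → FunSym ss s → Set
  SBFun (edge _)       = ⊥
  SBFun (sfun false _) = ⊤
  SBFun (sfun true _)  = ⊥
  SBFun (bfun false _) = ⊤
  SBFun (bfun true _)  = ⊥

  SBPred : ∀ {ss} → PredSym ss → Set
  SBPred (top _)         = ⊥
  SBPred (spred false _) = ⊤
  SBPred (spred true _)  = ⊥
  SBPred (bpred false _) = ⊤
  SBPred (bpred true _)  = ⊥

  mutual
    SBTerm : ∀ {Γ s} → Term Γ s → Set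
    SBTerm (var x)    = ⊤
    SBTerm (app f ts) = SBFun f × SBTerms ts

    SBTerms : ∀ {Γ ss} → Terms Γ ss → Set
    SBTerms []       = ⊤
    SBTerms (t ∷ ts) = SBTerm t × SBTerms ts

  OverSB : ∀ {Γ} → Formula Γ → Set
  OverSB tt          = ⊤
  OverSB ff          = ⊤
  OverSB (atom P ts) = SBPred P × SBTerms ts
  OverSB (eq t u)    = SBTerm t × SBTerm u
  OverSB (neg φ)     = OverSB φ
  OverSB (φ ∧ᶠ ψ)    = OverSB φ × OverSB ψ
  OverSB (φ ∨ᶠ ψ)    = OverSB φ × OverSB ψ
  OverSB (φ ⇒ᶠ ψ)    = OverSB φ × OverSB ψ
  OverSB (all s φ)   = OverSB φ
  OverSB (ex s φ)    = OverSB φ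

  modTerms : ∀ {Γ} → Γ ∋ proc → List (Term Γ proc)
  modTerms x = var x ∷ L.map (λ e → app (edge e) (var x ∷ [])) (L.allFin nE)

  data InMod {Γ} (x : Γ ∋ proc) : Term Γ proc → Set where
    is-p : InMod x (var x)
    is-f : ∀ e → InMod x (app (edge e) (var x ∷ []))

  mutual
    data LocalT {Γ} (x : Γ ∋ proc) : ∀ {s} → Term Γ s → Set where
      lproc : ∀ {t} → InMod x t → LocalT x t
      lvar  : ∀ {d} {y : Γ ∋ dat d} → LocalT x (var y)
      lapp  : ∀ {d ss} {f : FunSym ss (dat d)} {ts : Terms Γ ss} → LocalTs x ts → LocalT x (app f ts)

    data LocalTs {Γ} (x : Γ ∋ proc) : ∀ {ss} → Terms Γ ss → Set where
      []  : LocalTs x []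
      _∷_ : ∀ {s ss} {t : Term Γ s} {ts : Terms Γ ss} → LocalT x t → LocalTs x ts → LocalTs x (t ∷ ts)

  LocalF : ∀ {Γ} → Γ ∋ proc → Formula Γ → Set
  LocalF x tt          = ⊤
  LocalF x ff          = ⊤
  LocalF x (atom P ts) = LocalTs x ts
  LocalF x (eq t u)    = LocalT x t × LocalT x u
  LocalF x (neg φ)     = LocalF x φ
  LocalF x (φ ∧ᶠ ψ)    = LocalF x φ × LocalF x ψ
  LocalF x (φ ∨ᶠ ψ)    = LocalF x φ × LocalF x ψ
  LocalF x (φ ⇒ᶠ ψ)    = LocalF x φ × LocalF x ψ
  LocalF x (all s φ)   = LocalF (there x) φ
  LocalF x (ex s φ)    = LocalF (there x) φ

  ⋀ : ∀ {Γ n} → (Fin n → Formula Γ) → Formula Γ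
  ⋀ {n = zero}  φ = tt
  ⋀ {n = suc n} φ = φ zero ∧ᶠ ⋀ (φ ∘ suc)

  ⋀L : ∀ {Γ} → List (Formula Γ) → Formula Γ
  ⋀L []       = tt
  ⋀L (φ ∷ φs) = φ ∧ᶠ ⋀L φs

  ⋁L : ∀ {Γ} → List (Formula Γ) → Formula Γ
  ⋁L []       = ff
  ⋁L (φ ∷ φs) = φ ∨ᶠ ⋁L φs

  allN : ∀ {Γ} (ss : Ctx) → Formula (ss ++ Γ) → Formula Γ
  allN []       φ = φ
  allN (s ∷ ss) φ = allN ss (all s φ)

  wkL : ∀ {Γ s} (ss : Ctx) → Γ ∋ s → (ss ++ Γ) ∋ s
  wkL []       x = x
  wkL (_ ∷ ss) x = there (wkL ss x)

  prefixVars : ∀ {Γ} (ss : Ctx) → Terms (ss ++ Γ) ss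
  prefixVars []       = []
  prefixVars (s ∷ ss) = var here ∷ renTs there (prefixVars ss)

  vecTerms : ∀ {Γ n} → Vec (Term Γ proc) n → Terms Γ (procs n)
  vecTerms []       = []
  vecTerms (t ∷ ts) = t ∷ vecTerms ts

  vecSub : ∀ {Γ n} → Vec (Term Γ proc) n → Sub (procs n) Γ
  vecSub (t ∷ ts) here      = t
  vecSub (t ∷ ts) (there x) = vecSub ts x

  inst : ∀ {Γ n} → Formula (procs n) → Vec (Term Γ proc) n → Formula Γ
  inst φ ts = subF (vecSub ts) φ

  qvar : ∀ {Δ} n → Fin n → (procs n ++ Δ) ∋ proc
  qvar (suc n) zero    = here
  qvar (suc n) (suc i) = there (qvar n i)

  qvars : (Δ : Ctx) → Vec (Term (procs k ++ Δ) proc) k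
  qvars Δ = V.tabulate (λ i → var (qvar k i))

  Unch : ∀ {Γ} → Γ ∋ proc → Formula Γ
  Unch y =
    ⋀ (λ i → allN (dats (spArgs i))
         (atom (spred false i) (var (wkL _ y) ∷ prefixVars _)
            ⇔ᶠ atom (spred true i) (var (wkL _ y) ∷ prefixVars _)))
    ∧ᶠ ⋀ (λ i → allN (dats (sfArgs i))
         (eq (app (sfun false i) (var (wkL _ y) ∷ prefixVars _))
             (app (sfun true i) (var (wkL _ y) ∷ prefixVars _))))

  UnMod : ∀ {Γ} → Formula Γ
  UnMod =
    ⋀ (λ i → allN (dats (bpArgs i))
         (atom (bpred false i) (prefixVars _) ⇔ᶠ atom (bpred true i) (prefixVars _)))
    ∧ᶠ ⋀ (λ i → allN (dats (bfArgs i))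
         (eq (app (bfun false i) (prefixVars _)) (app (bfun true i) (prefixVars _))))

  NotIn : ∀ {Γ} → Γ ∋ proc → List (Term Γ proc) → Formula Γ
  NotIn y ts = ⋀L (L.map (λ t → neg (eq (var y) t)) ts)

  Frame : ∀ {Γ} → Γ ∋ proc → Formula Γ
  Frame p = UnMod ∧ᶠ all proc (NotIn here (modTerms (there p)) ⇒ᶠ Unch here)

  record Protocol : Set₁ where
    field
      C          : Topology
      InitT      : Fin nT → Formula (procs k)
      InitT-over : ∀ t → OverSB (InitT t)
      TrLoc      : Formula (proc ∷ [])
      TrLoc-loc  : LocalF here TrLoc
  open Protocol public

  guarded : ∀ {Γ} → (Fin nT → Formula (procs k)) → Vec (Term Γ proc) k → Formula Γ
  guarded φ ts = ⋀ (λ t → atom (top t) (vecTerms ts) ⇒ᶠ inst (φ t) ts)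

  τp : Protocol → Formula (proc ∷ [])
  τp P = TrLoc P ∧ᶠ Frame here

  τ : Protocol → Formula []
  τ P = ex proc (τp P)

  InvOk : Protocol → (Fin nT → Formula (procs k)) → Formula []
  InvOk P Inv =
    (allN (procs k) (guarded (InitT P) (qvars [])) ⇒ᶠ allN (procs k) (guarded Inv (qvars [])))
    ∧ᶠ ((allN (procs k) (guarded Inv (qvars [])) ∧ᶠ τ P)
          ⇒ᶠ allN (procs k) (primeF (guarded Inv (qvars []))))

  -- χ_Top(A, q⃗): CNF over Σ_T ∪ Σ_E ∪ {=}, Proc-terms among the list Ls
  -- (= A ∪ q⃗), Σ_T-literals positive.

  data Lit {Γ} (Ls : List (Term Γ proc)) : Set where
    topL : Fin nT → Vec (Fin (length Ls)) k → Lit Ls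
    eqL  : Fin (length Ls) → Fin (length Ls) → Lit Ls
    neqL : Fin (length Ls) → Fin (length Ls) → Lit Ls

  CNF : ∀ {Γ} → List (Term Γ proc) → Set
  CNF Ls = List (List (Lit Ls))

  litWith : ∀ {Γ} {Ls : List (Term Γ proc)} → (Fin nT → Vec (Term Γ proc) k → Formula Γ) → Lit Ls → Formula Γ
  litWith {Ls = Ls} g (topL t is) = g t (V.map (L.lookup Ls) is)
  litWith {Ls = Ls} g (eqL i j)   = eq (L.lookup Ls i) (L.lookup Ls j)
  litWith {Ls = Ls} g (neqL i j)  = neg (eq (L.lookup Ls i) (L.lookup Ls j))

  cnfWith : ∀ {Γ} {Ls : List (Term Γ proc)} → (Fin nT → Vec (Term Γ proc) k → Formula Γ) → CNF Ls → Formula Γ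
  cnfWith g χ = ⋀L (L.map (λ cl → ⋁L (L.map (litWith g) cl)) χ)

  cnfF : ∀ {Γ} {Ls : List (Term Γ proc)} → CNF Ls → Formula Γ
  cnfF = cnfWith (λ t ts → atom (top t) (vecTerms ts))

  IsStrongest : Topology → Fin nT → {Δ : Ctx} (Ls : List (Term (procs k ++ Δ) proc)) → CNF Ls → Set₁
  IsStrongest C t Ls χ =
    ValidC C (atom (top t) (vecTerms (qvars _)) ⇒ᶠ cnfF χ)
    × ((ψ : CNF Ls) → ValidC C (atom (top t) (vecTerms (qvars _)) ⇒ᶠ cnfF ψ)
                    → ValidC C (cnfF χ ⇒ᶠ cnfF ψ))

  pvar : (procs k ++ proc ∷ []) ∋ proc
  pvar = wkL (procs k) here

  AInit : List (Term (procs k ++ []) proc)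
  AInit = V.toList (qvars [])

  AMod : List (Term (procs k ++ proc ∷ []) proc)
  AMod = modTerms pvar ++ V.toList (qvars (proc ∷ []))

  record ChiChoice (C : Topology) : Set₁ where
    field
      chiInit      : Fin nT → CNF AInit
      chiInit-spec : ∀ t → IsStrongest C t AInit (chiInit t)
      chiMod       : Fin nT → CNF AMod
      chiMod-spec  : ∀ t → IsStrongest C t AMod (chiMod t)
  open ChiChoice public

  toP : Ren (proc ∷ []) (procs k ++ proc ∷ [])
  toP here = pvar
  toP (there ())

  CrossInit : (P : Protocol) → ChiChoice (C P) → Fin nT → Formula (procs k ++ [])
  CrossInit P χ t = cnfWith (λ j ts → inst (InitT P j) ts) (chiInit χ t)

  CrossInv : (P : Protocol) → ChiChoice (C P) → (Fin nT → Formula (procs k)) → Fin nT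
           → Formula (procs k ++ proc ∷ [])
  CrossInv P χ Inv t = cnfWith (λ j ts → atom (top j) (vecTerms ts) ∧ᶠ inst (Inv j) ts) (chiMod χ t)

  VC : (P : Protocol) → ChiChoice (C P) → (Fin nT → Formula (procs k)) → Formula []
  VC P χ Inv = ⋀ (λ t →
       allN (procs k) (CrossInit P χ t ⇒ᶠ inst (Inv t) (qvars []))
    ∧ᶠ all proc (allN (procs k)
         ((CrossInv P χ Inv t ∧ᶠ renF toP (τp P)) ⇒ᶠ primeF (inst (Inv t) (qvars (proc ∷ []))))))

-- Let M be a C-interpretation. Whenever Top(q⃗) holds in M, so does χ_Top(A, q⃗), since it is a
-- C-consequence of Top(q⃗). All Σ_T-literals of χ are positive, so replacing each atom Top_j(t⃗)
-- by a formula it implies in M keeps χ true: under ∀p⃗ Init(p⃗) every Top_j(t⃗) implies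
-- Init_Top_j(t⃗), and under ∀p⃗ Inv(p⃗) it implies Top_j(t⃗) ∧ Inv_Top_j(t⃗). Hence CrossInit and
-- CrossInv hold in M, and the VC, being valid, holds in M in particular and yields Inv resp. Inv'.
module Submission where

open import Defs
open import Data.Nat using (zero; suc)
open import Data.Fin using (Fin; zero; suc)
open import Data.Fin.Properties using (∀-cons-⇔)
open import Data.List using (List; []; _∷_; _++_)
import Data.List as L
open import Data.Vec using (Vec; []; _∷_)
import Data.Vec as V
open import Data.Product using (_×_; _,_; proj₁; proj₂)
import Data.Product as Product
open import Data.Product.Function.NonDependent.Propositional using (_×-⇔_)
open import Data.Product.Function.Dependent.Propositional using (Σ-⇔)
import Data.Sum as Sum
open import Data.Sum.Function.Propositional using (_⊎-⇔_)
open import Function using (_∘_; id)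
open import Function.Bundles using (_⇔_; mk⇔; Equivalence)
open import Function.Construct.Identity using (⇔-id; ↠-id)
open import Function.Construct.Composition using (_⇔-∘_)
open import Function.Related.TypeIsomorphisms using (→-cong-⇔; ¬-cong-⇔)
open import Relation.Binary.PropositionalEquality using (_≡_; refl; trans; cong; cong₂)

open Equivalence using (to; from)

Π-⇔ : ∀ {A : Set} {B C : A → Set} → (∀ x → B x ⇔ C x) → ((x : A) → B x) ⇔ ((x : A) → C x)
Π-⇔ B⇔C = mk⇔ (λ f x → to (B⇔C x) (f x)) (λ g x → from (B⇔C x) (g x))

subst-⇔ : ∀ {A : Set} (P : A → Set) {x y} → x ≡ y → P x ⇔ P y
subst-⇔ P refl = ⇔-id _

≡-cong-⇔ : ∀ {A : Set} {a a' b b' : A} → a ≡ a' → b ≡ b' → (a ≡ b) ⇔ (a' ≡ b')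
≡-cong-⇔ refl refl = ⇔-id _

module _ (S : ProtSig) where
  open FO S

  _++ᴱ_ : ∀ {E : Srt → Set} {ss Γ} → Env E ss → Env E Γ → Env E (ss ++ Γ)
  []       ++ᴱ ρ = ρ
  (d ∷ ρs) ++ᴱ ρ = d ∷ (ρs ++ᴱ ρ)

  lookupE-wkL : ∀ {E : Srt → Set} {ss Γ s} (ρs : Env E ss) (ρ : Env E Γ) (x : Γ ∋ s) →
                lookupE (ρs ++ᴱ ρ) (wkL ss x) ≡ lookupE ρ x
  lookupE-wkL []       ρ x = refl
  lookupE-wkL (d ∷ ρs) ρ x = lookupE-wkL ρs ρ x

  module Semantics (M : Structure) where

    RenAgrees : ∀ {Γ Δ} → Ren Γ Δ → Env (D M) Δ → Env (D M) Γ → Set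
    RenAgrees r ρ ρ' = ∀ {s} (x : _ ∋ s) → lookupE ρ (r x) ≡ lookupE ρ' x

    SubAgrees : ∀ {Γ Δ} → Sub Γ Δ → Env (D M) Δ → Env (D M) Γ → Set
    SubAgrees σ ρ ρ' = ∀ {s} (x : _ ∋ s) → evalT M ρ (σ x) ≡ lookupE ρ' x

    mutual
      evalT-renT : ∀ {Γ Δ s} {r : Ren Γ Δ} {ρ ρ'} → RenAgrees r ρ ρ' →
                   (t : Term Γ s) → evalT M ρ (renT r t) ≡ evalT M ρ' t
      evalT-renT H (var x)    = H x
      evalT-renT H (app f ts) = cong (funI M f) (evalTs-renTs H ts)

      evalTs-renTs : ∀ {Γ Δ ss} {r : Ren Γ Δ} {ρ ρ'} → RenAgrees r ρ ρ' →
                     (ts : Terms Γ ss) → evalTs M ρ (renTs r ts) ≡ evalTs M ρ' ts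
      evalTs-renTs H []       = refl
      evalTs-renTs H (t ∷ ts) = cong₂ _∷_ (evalT-renT H t) (evalTs-renTs H ts)

    liftR-agrees : ∀ {Γ Δ t} {r : Ren Γ Δ} {ρ ρ'} (d : D M t) →
                   RenAgrees r ρ ρ' → RenAgrees (liftR r) (d ∷ ρ) (d ∷ ρ')
    liftR-agrees d H here      = refl
    liftR-agrees d H (there x) = H x

    renF-sem : ∀ {Γ Δ} {r : Ren Γ Δ} {ρ ρ'} → RenAgrees r ρ ρ' →
               (φ : Formula Γ) → ⟦ renF r φ ⟧ M ρ ⇔ ⟦ φ ⟧ M ρ'
    renF-sem H tt          = ⇔-id _
    renF-sem H ff          = ⇔-id _
    renF-sem H (atom P ts) = subst-⇔ (predI M P) (evalTs-renTs H ts)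
    renF-sem H (eq t u)    = ≡-cong-⇔ (evalT-renT H t) (evalT-renT H u)
    renF-sem H (neg φ)     = ¬-cong-⇔ (renF-sem H φ)
    renF-sem H (φ ∧ᶠ ψ)    = renF-sem H φ ×-⇔ renF-sem H ψ
    renF-sem H (φ ∨ᶠ ψ)    = renF-sem H φ ⊎-⇔ renF-sem H ψ
    renF-sem H (φ ⇒ᶠ ψ)    = →-cong-⇔ (renF-sem H φ) (renF-sem H ψ)
    renF-sem H (all s φ)   = Π-⇔ λ d → renF-sem (liftR-agrees d H) φ
    renF-sem H (ex s φ)    = Σ-⇔ (↠-id _) λ {d} → renF-sem (liftR-agrees d H) φ

    mutual
      evalT-subT : ∀ {Γ Δ s} {σ : Sub Γ Δ} {ρ ρ'} → SubAgrees σ ρ ρ' →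
                   (t : Term Γ s) → evalT M ρ (subT σ t) ≡ evalT M ρ' t
      evalT-subT H (var x)    = H x
      evalT-subT H (app f ts) = cong (funI M f) (evalTs-subTs H ts)

      evalTs-subTs : ∀ {Γ Δ ss} {σ : Sub Γ Δ} {ρ ρ'} → SubAgrees σ ρ ρ' →
                     (ts : Terms Γ ss) → evalTs M ρ (subTs σ ts) ≡ evalTs M ρ' ts
      evalTs-subTs H []       = refl
      evalTs-subTs H (t ∷ ts) = cong₂ _∷_ (evalT-subT H t) (evalTs-subTs H ts)

    liftS-agrees : ∀ {Γ Δ t} {σ : Sub Γ Δ} {ρ ρ'} (d : D M t) →
                   SubAgrees σ ρ ρ' → SubAgrees (liftS σ) (d ∷ ρ) (d ∷ ρ')
    liftS-agrees d H here                = refl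
    liftS-agrees {σ = σ} d H (there x) = trans (evalT-renT (λ _ → refl) (σ x)) (H x)

    subF-sem : ∀ {Γ Δ} {σ : Sub Γ Δ} {ρ ρ'} → SubAgrees σ ρ ρ' →
               (φ : Formula Γ) → ⟦ subF σ φ ⟧ M ρ ⇔ ⟦ φ ⟧ M ρ'
    subF-sem H tt          = ⇔-id _
    subF-sem H ff          = ⇔-id _
    subF-sem H (atom P ts) = subst-⇔ (predI M P) (evalTs-subTs H ts)
    subF-sem H (eq t u)    = ≡-cong-⇔ (evalT-subT H t) (evalT-subT H u)
    subF-sem H (neg φ)     = ¬-cong-⇔ (subF-sem H φ)
    subF-sem H (φ ∧ᶠ ψ)    = subF-sem H φ ×-⇔ subF-sem H ψ
    subF-sem H (φ ∨ᶠ ψ)    = subF-sem H φ ⊎-⇔ subF-sem H ψ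
    subF-sem H (φ ⇒ᶠ ψ)    = →-cong-⇔ (subF-sem H φ) (subF-sem H ψ)
    subF-sem H (all s φ)   = Π-⇔ λ d → subF-sem (liftS-agrees d H) φ
    subF-sem H (ex s φ)    = Σ-⇔ (↠-id _) λ {d} → subF-sem (liftS-agrees d H) φ

    vecSub-agrees : ∀ {Γ n} (ts : Vec (Term Γ proc) n) {ρ : Env (D M) Γ} →
                    SubAgrees (vecSub ts) ρ (evalTs M ρ (vecTerms ts))
    vecSub-agrees (t ∷ ts) here      = refl
    vecSub-agrees (t ∷ ts) (there x) = vecSub-agrees ts x

    inst-sem : ∀ {Γ n} (φ : Formula (procs n)) (ts : Vec (Term Γ proc) n) (ρ : Env (D M) Γ) →
               ⟦ inst φ ts ⟧ M ρ ⇔ ⟦ φ ⟧ M (evalTs M ρ (vecTerms ts))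
    inst-sem φ ts ρ = subF-sem (vecSub-agrees ts) φ

    evalTs-tabulate-qvar : ∀ {Δ Γ} n {r : Ren (procs n ++ Δ) Γ} {ρ} (ρs : Env (D M) (procs n)) {ρr} →
                           RenAgrees r ρ (ρs ++ᴱ ρr) →
                           evalTs M ρ (vecTerms (V.tabulate (var ∘ r ∘ qvar n))) ≡ ρs
    evalTs-tabulate-qvar zero    []       H = refl
    evalTs-tabulate-qvar (suc n) (d ∷ ρs) H = cong₂ _∷_ (H here) (evalTs-tabulate-qvar n ρs (H ∘ there))

    evalTs-qvars : ∀ {Δ} (ρs : Env (D M) (procs k)) (ρr : Env (D M) Δ) →
                   evalTs M (ρs ++ᴱ ρr) (vecTerms (qvars Δ)) ≡ ρs
    evalTs-qvars ρs ρr = evalTs-tabulate-qvar k ρs (λ _ → refl)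

    inst-qvars-sem : ∀ {Δ} (φ : Formula (procs k)) (ρs : Env (D M) (procs k)) (ρr : Env (D M) Δ) →
                     ⟦ inst φ (qvars Δ) ⟧ M (ρs ++ᴱ ρr) ⇔ ⟦ φ ⟧ M ρs
    inst-qvars-sem φ ρs ρr = subst-⇔ (⟦ φ ⟧ M) (evalTs-qvars ρs ρr) ⇔-∘ inst-sem φ (qvars _) (ρs ++ᴱ ρr)

    top-qvars-sem : ∀ {Δ} t (ρs : Env (D M) (procs k)) (ρr : Env (D M) Δ) →
                    ⟦ atom (top t) (vecTerms (qvars Δ)) ⟧ M (ρs ++ᴱ ρr) ⇔ predI M (top t) ρs
    top-qvars-sem t ρs ρr = subst-⇔ (predI M (top t)) (evalTs-qvars ρs ρr)

    allN-sem : ∀ {Γ} ss (φ : Formula (ss ++ Γ)) (ρ : Env (D M) Γ) →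
               ⟦ allN ss φ ⟧ M ρ ⇔ ((ρs : Env (D M) ss) → ⟦ φ ⟧ M (ρs ++ᴱ ρ))
    allN-sem []       φ ρ = mk⇔ (λ h → λ { [] → h }) (λ h → h [])
    allN-sem (s ∷ ss) φ ρ =
      mk⇔ (λ h → λ { (d ∷ ρs) → to ih h ρs d }) (λ h → from ih λ ρs d → h (d ∷ ρs))
      where ih = allN-sem ss (all s φ) ρ

    ⋀-sem : ∀ {Γ n} (φ : Fin n → Formula Γ) (ρ : Env (D M) Γ) → ⟦ ⋀ φ ⟧ M ρ ⇔ (∀ i → ⟦ φ i ⟧ M ρ)
    ⋀-sem {n = zero}  φ ρ = mk⇔ (λ _ ()) (λ _ → _)
    ⋀-sem {n = suc n} φ ρ = ∀-cons-⇔ ⇔-∘ (⇔-id _ ×-⇔ ⋀-sem (φ ∘ suc) ρ)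

    module _ {Γ} {Ls : List (Term Γ proc)} {g g' : Fin nT → Vec (Term Γ proc) k → Formula Γ}
             {ρ : Env (D M) Γ} (g⇒g' : ∀ t ts → ⟦ g t ts ⟧ M ρ → ⟦ g' t ts ⟧ M ρ) where

      litWith-mono : (l : Lit Ls) → ⟦ litWith g l ⟧ M ρ → ⟦ litWith g' l ⟧ M ρ
      litWith-mono (topL t is) = g⇒g' t _
      litWith-mono (eqL i j)   = id
      litWith-mono (neqL i j)  = id

      clause-mono : (cl : List (Lit Ls)) →
                    ⟦ ⋁L (L.map (litWith g) cl) ⟧ M ρ → ⟦ ⋁L (L.map (litWith g') cl) ⟧ M ρ
      clause-mono []       ()
      clause-mono (l ∷ cl) = Sum.map (litWith-mono l) (clause-mono cl)

      cnfWith-mono : (χ : CNF Ls) → ⟦ cnfWith g χ ⟧ M ρ → ⟦ cnfWith g' χ ⟧ M ρ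
      cnfWith-mono []       _ = _
      cnfWith-mono (cl ∷ χ) = Product.map (clause-mono cl) (cnfWith-mono χ)

    guarded-inst : (F : Fin nT → Formula (procs k)) →
                   ⟦ allN (procs k) (guarded F (qvars [])) ⟧ M [] →
                   ∀ {Γ} (ρ : Env (D M) Γ) t (ts : Vec (Term Γ proc) k) →
                   ⟦ atom (top t) (vecTerms ts) ⟧ M ρ → ⟦ inst (F t) ts ⟧ M ρ
    guarded-inst F ∀F ρ t ts Top-ts =
      from (inst-sem (F t) ts ρ)
        (to (inst-qvars-sem (F t) e [])
          (to (⋀-sem _ (e ++ᴱ [])) (to (allN-sem (procs k) _ []) ∀F e) t
            (from (top-qvars-sem t e []) Top-ts)))
      where e = evalTs M ρ (vecTerms ts)

  primedStructure : Structure → Structure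
  primedStructure M = record
    { D = D M ; inhabited = inhabited M
    ; funI = funI M ∘ primeFun ; predI = predI M ∘ primePred }

  module _ (M : Structure) where
    private M' = primedStructure M

    mutual
      evalT-primeT : ∀ {Γ s} (ρ : Env (D M) Γ) (t : Term Γ s) → evalT M ρ (primeT t) ≡ evalT M' ρ t
      evalT-primeT ρ (var x)    = refl
      evalT-primeT ρ (app f ts) = cong (funI M (primeFun f)) (evalTs-primeTs ρ ts)

      evalTs-primeTs : ∀ {Γ ss} (ρ : Env (D M) Γ) (ts : Terms Γ ss) → evalTs M ρ (primeTs ts) ≡ evalTs M' ρ ts
      evalTs-primeTs ρ []       = refl
      evalTs-primeTs ρ (t ∷ ts) = cong₂ _∷_ (evalT-primeT ρ t) (evalTs-primeTs ρ ts)

    primeF-sem : ∀ {Γ} (φ : Formula Γ) (ρ : Env (D M) Γ) → ⟦ primeF φ ⟧ M ρ ⇔ ⟦ φ ⟧ M' ρ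
    primeF-sem tt          ρ = ⇔-id _
    primeF-sem ff          ρ = ⇔-id _
    primeF-sem (atom P ts) ρ = subst-⇔ (predI M (primePred P)) (evalTs-primeTs ρ ts)
    primeF-sem (eq t u)    ρ = ≡-cong-⇔ (evalT-primeT ρ t) (evalT-primeT ρ u)
    primeF-sem (neg φ)     ρ = ¬-cong-⇔ (primeF-sem φ ρ)
    primeF-sem (φ ∧ᶠ ψ)    ρ = primeF-sem φ ρ ×-⇔ primeF-sem ψ ρ
    primeF-sem (φ ∨ᶠ ψ)    ρ = primeF-sem φ ρ ⊎-⇔ primeF-sem ψ ρ
    primeF-sem (φ ⇒ᶠ ψ)    ρ = →-cong-⇔ (primeF-sem φ ρ) (primeF-sem ψ ρ)
    primeF-sem (all s φ)   ρ = Π-⇔ λ d → primeF-sem φ (d ∷ ρ)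
    primeF-sem (ex s φ)    ρ = Σ-⇔ (↠-id _) λ {d} → primeF-sem φ (d ∷ ρ)

  module _ (P : Protocol) (Inv : Fin nT → Formula (procs k)) (χ : ChiChoice (C P))
           (M : Structure) (isC : IsCInterp (C P) M) where
    open Semantics M

    AllGuarded : (Fin nT → Formula (procs k)) → Set
    AllGuarded F = ⟦ allN (procs k) (guarded F (qvars [])) ⟧ M []

    crossInit-holds : AllGuarded (InitT P) → ∀ t (ρs : Env (D M) (procs k)) →
                      predI M (top t) ρs → ⟦ CrossInit P χ t ⟧ M (ρs ++ᴱ [])
    crossInit-holds ∀Init t ρs Top-ρs =
      cnfWith-mono (guarded-inst (InitT P) ∀Init ρ) (chiInit χ t)
        (proj₁ (chiInit-spec χ t) M isC ρ (from (top-qvars-sem t ρs []) Top-ρs))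
      where ρ = ρs ++ᴱ []

    crossInv-holds : AllGuarded Inv → ∀ t (ρs : Env (D M) (procs k)) (p : D M proc) →
                     predI M (top t) ρs → ⟦ CrossInv P χ Inv t ⟧ M (ρs ++ᴱ (p ∷ []))
    crossInv-holds ∀Inv t ρs p Top-ρs =
      cnfWith-mono (λ j ts Top-ts → Top-ts , guarded-inst Inv ∀Inv ρ j ts Top-ts) (chiMod χ t)
        (proj₁ (chiMod-spec χ t) M isC ρ (from (top-qvars-sem t ρs (p ∷ [])) Top-ρs))
      where ρ = ρs ++ᴱ (p ∷ [])

    toP-agrees : (ρs : Env (D M) (procs k)) (p : D M proc) → RenAgrees toP (ρs ++ᴱ (p ∷ [])) (p ∷ [])
    toP-agrees ρs p here = lookupE-wkL ρs (p ∷ []) here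

    module _ (vc : Valid (VC P χ Inv)) where
      private
        M' = primedStructure M
        module M' = Semantics M'

      vc-init : ∀ t (ρs : Env (D M) (procs k)) →
                ⟦ CrossInit P χ t ⟧ M (ρs ++ᴱ []) → ⟦ inst (Inv t) (qvars []) ⟧ M (ρs ++ᴱ [])
      vc-init t = to (allN-sem (procs k) _ []) (proj₁ (to (⋀-sem _ []) (vc M []) t))

      vc-step : ∀ t (p : D M proc) (ρs : Env (D M) (procs k)) →
                ⟦ CrossInv P χ Inv t ∧ᶠ renF toP (τp P) ⟧ M (ρs ++ᴱ (p ∷ [])) →
                ⟦ primeF (inst (Inv t) (qvars (proc ∷ []))) ⟧ M (ρs ++ᴱ (p ∷ []))
      vc-step t p = to (allN-sem (procs k) _ (p ∷ [])) (proj₂ (to (⋀-sem _ []) (vc M []) t) p)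

      initiation : AllGuarded (InitT P) → AllGuarded Inv
      initiation ∀Init = from (allN-sem (procs k) _ []) λ ρs → from (⋀-sem _ (ρs ++ᴱ [])) λ t Top-q →
        vc-init t ρs (crossInit-holds ∀Init t ρs (to (top-qvars-sem t ρs []) Top-q))

      Inv-after-step : AllGuarded Inv → (p : D M proc) → ⟦ τp P ⟧ M (p ∷ []) →
                       ∀ t (ρs : Env (D M) (procs k)) → predI M (top t) ρs → ⟦ Inv t ⟧ M' ρs
      Inv-after-step ∀Inv p τ-p t ρs Top-ρs =
        to (M'.inst-qvars-sem (Inv t) ρs (p ∷ []))
          (to (primeF-sem M (inst (Inv t) (qvars (proc ∷ []))) (ρs ++ᴱ (p ∷ [])))
            (vc-step t p ρs (crossInv-holds ∀Inv t ρs p Top-ρs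
                           , from (renF-sem (toP-agrees ρs p) (τp P)) τ-p)))

      consecution : AllGuarded Inv × ⟦ τ P ⟧ M [] →
                    ⟦ allN (procs k) (primeF (guarded Inv (qvars []))) ⟧ M []
      consecution (∀Inv , p , τ-p) = from (allN-sem (procs k) _ []) λ ρs →
        from (primeF-sem M (guarded Inv (qvars [])) (ρs ++ᴱ [])) (from (M'.⋀-sem _ (ρs ++ᴱ [])) λ t Top-q →
          from (M'.inst-qvars-sem (Inv t) ρs [])
            (Inv-after-step ∀Inv p τ-p t ρs (to (M'.top-qvars-sem t ρs []) Top-q)))

theorem1 : (S : ProtSig) → let open FO S in
           (P : Protocol) (Inv : Fin nT → Formula (procs k)) →
           (∀ t → OverSB (Inv t)) →
           (χ : ChiChoice (C P)) →
           Valid (VC P χ Inv) →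
           ValidC (C P) (InvOk P Inv)
theorem1 S P Inv _ χ vc M isC FO.[] =
  initiation S P Inv χ M isC vc , consecution S P Inv χ M isC vc
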